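{- Let $d\ge 2$ be an integer and let $T$ be a tournament. If $T$ is critical $d$-dominating, then $T^*$ cannot be covered by fewer than $d+1$ $(d+1)$-dominating subgraphs, i.e. there do not exist $t\le d$ subgraphs $H_1,\dots,H_t$ of $T^*$, each $(d+1)$-dominating, with $\bigcup_{i=1}^t V(H_i)=V(T^*)$.
   Context: A digraph is a pair $(V,E)$ with $E\subseteq V\times V$ (loops allowed); a subgraph is $(V',E')$ with $V'\subseteq V$, $E'\subseteq E\cap (V'\times V')$. A set $X$ dominates a vertex $w$ if $(x,w)\in E$ for all $x\in X$. A digraph is $d$-dominating if every $S\subseteq V$ with $1\le|S|\le d$ dominates some vertex $w\in V$ (possibly $w\in S$, which requires the loop $(w,w)\in E$). A tournament is a digraph such that for all distinct $x,y$ exactly one of $(x,y),(y,x)$ is an edge, and there are no loops. A $d$-dominating tournament is critical if none of its proper subtournaments is $d$-dominating. For a tournament $T$, $T^*$ is the digraph obtained from $T$ by adding a loop at every vertex. -}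

module Defs where

open import Data.Nat using (ℕ; _≤_; suc)
open import Data.Fin using (Fin)
open import Data.Fin.Subset using (Subset; _∈_; _∉_; _⊆_; ∣_∣; ⊤; Nonempty)
open import Data.Product using (_×_; ∃; Σ)
open import Data.Sum using (_⊎_)
open import Relation.Nullary using (¬_)
open import Relation.Binary.PropositionalEquality using (_≡_; _≢_)

Digraph : ℕ → Set₁
Digraph n = Fin n → Fin n → Set

record Subgraph {n : ℕ} (E : Digraph n) : Set₁ where
  field
    verts  : Subset n
    edges  : Digraph n
    edges⊆ : ∀ x y → edges x y → (x ∈ verts) × (y ∈ verts) × E x y
open Subgraph public

Dominates : {n : ℕ} → Digraph n → Subset n → Fin n → Set
Dominates E X w = ∀ x → x ∈ X → E x w

IsDominatingOn : {n : ℕ} → ℕ → Subset n → Digraph n → Set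
IsDominatingOn d V E =
  ∀ (S : Subset _) → S ⊆ V → 1 ≤ ∣ S ∣ → ∣ S ∣ ≤ d →
  ∃ λ w → (w ∈ V) × Dominates E S w

IsDominating : {n : ℕ} → ℕ → Digraph n → Set
IsDominating d E = IsDominatingOn d ⊤ E

IsDominatingSub : {n : ℕ} {E : Digraph n} → ℕ → Subgraph E → Set
IsDominatingSub d H = IsDominatingOn d (verts H) (edges H)

IsTournamentOn : {n : ℕ} → Subset n → Digraph n → Set
IsTournamentOn V E =
  (∀ x → x ∈ V → ¬ E x x) ×
  (∀ x y → x ∈ V → y ∈ V → x ≢ y → E x y ⊎ E y x) ×
  (∀ x y → x ∈ V → y ∈ V → E x y → ¬ E y x)

IsTournament : {n : ℕ} → Digraph n → Set
IsTournament E = IsTournamentOn ⊤ E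

-- A subtournament with
-- full vertex set necessarily has all edges of T, so "proper" means
-- that some vertex is missing.
IsCriticalDominating : {n : ℕ} → ℕ → Digraph n → Set₁
IsCriticalDominating d E =
  IsDominating d E ×
  (∀ (H : Subgraph E) → IsTournamentOn (verts H) (edges H) →
     Nonempty (verts H) → (∃ λ v → v ∉ verts H) →
     ¬ IsDominatingSub d H)

Star : {n : ℕ} → Digraph n → Digraph n
Star E x y = E x y ⊎ x ≡ y

-- Call s a sink of U if every other vertex of U beats s.  If some H_i
-- had all of V(T) as vertex set, deleting one vertex from T would leave a
-- d-dominating subtournament; so every H_i misses a vertex.  A nonempty
-- part U = V(H_i) must then have a sink: otherwise the (d+1)-domination of
-- H_i makes T restricted to U d-dominating, again contradicting
-- criticality.  The at most t ≤ d sinks of the parts form a set X which T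
-- dominates by some w; but w lies in a part whose sink s ∈ X satisfies
-- both s → w and w → s.
module Submission where

open import Defs
open import Data.Nat using (ℕ; suc; _+_; _≤_; z≤n; s≤s)
open import Data.Nat.Properties using (≤-trans; ≤-reflexive; n≤1+n; m≤n⇒m≤1+n; +-suc; +-monoʳ-≤; +-mono-≤)
open import Data.Fin using (Fin; zero)
open import Data.Fin.Properties using (_≟_; any?; all?; ¬∀⟶∃¬)
open import Data.Fin.Subset using (Subset; _∈_; _∉_; _⊆_; ∣_∣; ⊤; ⊥; ⁅_⁆; _∪_; ∁; ⋃; Nonempty; inside; outside)
open import Data.Fin.Subset.Properties using (_∈?_; ∈⊤; ∉⊥; ∣⊥∣≡0; x∈⁅x⁆; x∈⁅y⁆⇒x≡y; ∣⁅x⁆∣≡1; p⊆q⇒∣p∣≤∣q∣; x∈p∪q⁺; x∈p∪q⁻; x∈∁p⇒x∉p; x∉p⇒x∈∁p)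
open import Data.List using (List; []; _∷_; length; tabulate)
open import Data.List.Properties using (length-tabulate)
open import Data.List.Relation.Unary.All using (All; []; _∷_)
import Data.List.Relation.Unary.All.Properties as All
open import Data.List.Relation.Unary.Any using (Any; here; there)
import Data.List.Relation.Unary.Any.Properties as Any
open import Data.Vec using ([]; _∷_)
open import Data.Product using (_×_; ∃; Σ; _,_; proj₁; proj₂)
open import Data.Sum using (_⊎_; inj₁; inj₂)
open import Data.Empty using (⊥-elim)
open import Function using (_∘_)
open import Relation.Nullary using (¬_; Dec; yes; no)
open import Relation.Nullary.Decidable using (_→-dec_; _×-dec_; ¬?; decidable-stable)
open import Relation.Binary.PropositionalEquality using (_≡_; _≢_; refl; sym; cong; subst)

private
  variable
    n k : ℕ

∣p∪q∣≤∣p∣+∣q∣ : (p q : Subset n) → ∣ p ∪ q ∣ ≤ ∣ p ∣ + ∣ q ∣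
∣p∪q∣≤∣p∣+∣q∣ []            []            = z≤n
∣p∪q∣≤∣p∣+∣q∣ (outside ∷ p) (outside ∷ q) = ∣p∪q∣≤∣p∣+∣q∣ p q
∣p∪q∣≤∣p∣+∣q∣ (outside ∷ p) (inside ∷ q)  =
  ≤-trans (s≤s (∣p∪q∣≤∣p∣+∣q∣ p q)) (≤-reflexive (sym (+-suc ∣ p ∣ ∣ q ∣)))
∣p∪q∣≤∣p∣+∣q∣ (inside ∷ p)  (outside ∷ q) = s≤s (∣p∪q∣≤∣p∣+∣q∣ p q)
∣p∪q∣≤∣p∣+∣q∣ (inside ∷ p)  (inside ∷ q)  =
  s≤s (≤-trans (∣p∪q∣≤∣p∣+∣q∣ p q) (+-monoʳ-≤ ∣ p ∣ (n≤1+n ∣ q ∣)))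

∣⁅x⁆∪p∣≤1+∣p∣ : (x : Fin n) (p : Subset n) → ∣ ⁅ x ⁆ ∪ p ∣ ≤ suc ∣ p ∣
∣⁅x⁆∪p∣≤1+∣p∣ x p =
  ≤-trans (∣p∪q∣≤∣p∣+∣q∣ ⁅ x ⁆ p) (≤-reflexive (cong (_+ ∣ p ∣) (∣⁅x⁆∣≡1 x)))

x∈p⇒1≤∣p∣ : {x : Fin n} {p : Subset n} → x ∈ p → 1 ≤ ∣ p ∣
x∈p⇒1≤∣p∣ {x = x} {p} x∈p =
  subst (_≤ ∣ p ∣) (∣⁅x⁆∣≡1 x)
        (p⊆q⇒∣p∣≤∣q∣ (λ y∈⁅x⁆ → subst (_∈ p) (sym (x∈⁅y⁆⇒x≡y x y∈⁅x⁆)) x∈p))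

∣⋃∣≤length : {ps : List (Subset n)} → All (λ p → ∣ p ∣ ≤ 1) ps → ∣ ⋃ ps ∣ ≤ length ps
∣⋃∣≤length {n = n} []                 = ≤-reflexive (∣⊥∣≡0 n)
∣⋃∣≤length {ps = p ∷ ps} (∣p∣≤1 ∷ ≤1s) =
  ≤-trans (∣p∪q∣≤∣p∣+∣q∣ p (⋃ ps)) (+-mono-≤ ∣p∣≤1 (∣⋃∣≤length ≤1s))

x∈⋃⁺ : {x : Fin n} {ps : List (Subset n)} → Any (x ∈_) ps → x ∈ ⋃ ps
x∈⋃⁺                  (here x∈p)    = x∈p∪q⁺ (inj₁ x∈p)
x∈⋃⁺ {ps = p ∷ _}     (there x∈ps)  = x∈p∪q⁺ {p = p} (inj₂ (x∈⋃⁺ x∈ps))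

IsDominatingOn-mono : {U : Subset n} {E F : Digraph n} → (∀ x y → E x y → F x y) →
                      IsDominatingOn k U E → IsDominatingOn k U F
IsDominatingOn-mono E⇒F dom S S⊆U 1≤∣S∣ ∣S∣≤k with dom S S⊆U 1≤∣S∣ ∣S∣≤k
... | w , w∈U , S→w = w , w∈U , λ x x∈S → E⇒F x w (S→w x x∈S)

IsDominatingOn-full : {U : Subset n} {E : Digraph n} → (∀ x → x ∈ U) →
                      IsDominatingOn k U E → IsDominating k E
IsDominatingOn-full full dom S _ 1≤∣S∣ ∣S∣≤k with dom S (λ {x} _ → full x) 1≤∣S∣ ∣S∣≤k
... | w , _ , S→w = w , ∈⊤ , S→w

out-neighbour : {E : Digraph n} → IsDominating k E → 1 ≤ k → ∀ a → ∃ λ w → E a w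
out-neighbour dom 1≤k a with dom ⁅ a ⁆ (λ _ → ∈⊤) (x∈p⇒1≤∣p∣ (x∈⁅x⁆ a))
                                (≤-trans (≤-reflexive (∣⁅x⁆∣≡1 a)) 1≤k)
... | w , _ , a→w = w , a→w a (x∈⁅x⁆ a)

common-out-neighbour : {E : Digraph n} → IsDominating k E → 2 ≤ k →
                       ∀ a b → ∃ λ w → E a w × E b w
common-out-neighbour dom 2≤k a b
  with dom (⁅ a ⁆ ∪ ⁅ b ⁆) (λ _ → ∈⊤) (x∈p⇒1≤∣p∣ (x∈p∪q⁺ (inj₁ (x∈⁅x⁆ a))))
           (≤-trans (∣⁅x⁆∪p∣≤1+∣p∣ a ⁅ b ⁆) (≤-trans (≤-reflexive (cong suc (∣⁅x⁆∣≡1 b))) 2≤k))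
... | w , _ , ab→w = w , ab→w a (x∈p∪q⁺ (inj₁ (x∈⁅x⁆ a)))
                       , ab→w b (x∈p∪q⁺ {p = ⁅ a ⁆} (inj₂ (x∈⁅x⁆ b)))

Star-strict : {E : Digraph n} {x y : Fin n} → Star E x y → x ≢ y → E x y
Star-strict (inj₁ e)    _   = e
Star-strict (inj₂ x≡y) x≢y = ⊥-elim (x≢y x≡y)

induced : {E : Digraph n} → Subset n → Subgraph E
induced {E = E} U = record
  { verts  = U
  ; edges  = λ x y → x ∈ U × y ∈ U × E x y
  ; edges⊆ = λ _ _ e → e
  }

induced-dominating : {E : Digraph n} {U : Subset n} →
                     IsDominatingOn k U E → IsDominatingSub k (induced {E = E} U)
induced-dominating dom S S⊆U 1≤∣S∣ ∣S∣≤k with dom S S⊆U 1≤∣S∣ ∣S∣≤k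
... | w , w∈U , S→w = w , w∈U , λ x x∈S → S⊆U x∈S , w∈U , S→w x x∈S

module Tournament {T : Digraph n} (tournament : IsTournament T) where

  irrefl : ∀ {x} → ¬ T x x
  irrefl {x} = proj₁ tournament x ∈⊤

  total : ∀ {x y} → x ≢ y → T x y ⊎ T y x
  total {x} {y} = proj₁ (proj₂ tournament) x y ∈⊤ ∈⊤

  asym : ∀ {x y} → T x y → ¬ T y x
  asym {x} {y} = proj₂ (proj₂ tournament) x y ∈⊤ ∈⊤

  Star-asym : ∀ {x y} → Star T x y → ¬ T y x
  Star-asym (inj₁ xy)  = asym xy
  Star-asym (inj₂ refl) = irrefl

  edge? : ∀ x y → Dec (T x y)
  edge? x y with x ≟ y
  ... | yes refl = no irrefl
  ... | no x≢y with total x≢y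
  ...   | inj₁ xy = yes xy
  ...   | inj₂ yx = no (asym yx)

  Sink : Subset n → Fin n → Set
  Sink U s = ∀ x → x ∈ U → x ≢ s → T x s

  HasSink : Subset n → Set
  HasSink U = ∃ λ s → s ∈ U × Sink U s

  beats? : ∀ U s x → Dec (x ∈ U → x ≢ s → T x s)
  beats? U s x = (x ∈? U) →-dec (¬? (x ≟ s) →-dec edge? x s)

  hasSink? : ∀ U → Dec (HasSink U)
  hasSink? U = any? λ s → (s ∈? U) ×-dec all? (beats? U s)

  sink-unique : ∀ {S s s′} → s ∈ S → s′ ∈ S → Sink S s → Sink S s′ → s ≡ s′
  sink-unique {s = s} {s′} s∈S s′∈S sink sink′ with s ≟ s′
  ... | yes s≡s′ = s≡s′
  ... | no s≢s′  = ⊥-elim (asym (sink′ s s∈S s≢s′) (sink s′ s′∈S (s≢s′ ∘ sym)))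

  ¬Sink⇒out-neighbour : ∀ {U s} → ¬ Sink U s → ∃ λ y → y ∈ U × T s y
  ¬Sink⇒out-neighbour {U} {s} ¬sink
    with ¬∀⟶∃¬ n _ (beats? U s) ¬sink
  ... | y , ¬beats = y , y∈U , s→y
    where
    y∈U : y ∈ U
    y∈U = decidable-stable (y ∈? U) (λ y∉U → ¬beats (λ y∈U → ⊥-elim (y∉U y∈U)))
    s→y : T s y
    s→y with total {s} {y} (λ { refl → ¬beats (λ _ s≢s → ⊥-elim (s≢s refl)) })
    ... | inj₁ sy = sy
    ... | inj₂ ys = ⊥-elim (¬beats (λ _ _ → ys))

  Star-dominated : ∀ {X w} → Dominates (Star T) X w →
                   (w ∈ X × Sink X w) ⊎ (w ∉ X × Dominates T X w)
  Star-dominated {X} {w} X→w with w ∈? X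
  ... | yes w∈X = inj₁ (w∈X , λ x x∈X x≢w → Star-strict {E = T} (X→w x x∈X) x≢w)
  ... | no w∉X  = inj₂ (w∉X , λ x x∈X → Star-strict {E = T} (X→w x x∈X) λ { refl → w∉X x∈X })

  induced-tournament : (U : Subset n) → IsTournamentOn U (edges (induced {E = T} U))
  induced-tournament U = (λ _ _ e → irrefl (proj₂ (proj₂ e)))
                       , (λ _ _ x∈U y∈U x≢y → orient x∈U y∈U (total x≢y))
                       , (λ _ _ _ _ e e′ → asym (proj₂ (proj₂ e)) (proj₂ (proj₂ e′)))
    where
    orient : ∀ {x y} → x ∈ U → y ∈ U → T x y ⊎ T y x →
             edges (induced {E = T} U) x y ⊎ edges (induced {E = T} U) y x
    orient x∈U y∈U (inj₁ xy) = inj₁ (x∈U , y∈U , xy)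
    orient x∈U y∈U (inj₂ yx) = inj₂ (y∈U , x∈U , yx)

  critical⇒¬dominatingOn : ∀ {d U} → IsCriticalDominating d T → Nonempty U →
                           (∃ λ v → v ∉ U) → ¬ IsDominatingOn d U T
  critical⇒¬dominatingOn {U = U} (_ , minimal) nonempty missing dom =
    minimal (induced U) (induced-tournament U) nonempty missing (induced-dominating dom)

  module _ {d} {U : Subset n} (dom : IsDominatingOn (suc d) U (Star T)) where

    extend : ∀ {S y} → S ⊆ U → ∣ S ∣ ≤ d → y ∈ U → y ∉ S →
             (∃ λ w → w ∈ U × Dominates T S w × Star T y w) ⊎
             (∃ λ s → s ∈ S × Sink S s × T y s)
    extend {S} {y} S⊆U ∣S∣≤d y∈U y∉S
      with dom (⁅ y ⁆ ∪ S) y∪S⊆U (x∈p⇒1≤∣p∣ (x∈p∪q⁺ (inj₁ (x∈⁅x⁆ y))))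
               (≤-trans (∣⁅x⁆∪p∣≤1+∣p∣ y S) (s≤s ∣S∣≤d))
      where
      y∪S⊆U : ⁅ y ⁆ ∪ S ⊆ U
      y∪S⊆U x∈ with x∈p∪q⁻ ⁅ y ⁆ S x∈
      ... | inj₁ x∈⁅y⁆ = subst (_∈ U) (sym (x∈⁅y⁆⇒x≡y y x∈⁅y⁆)) y∈U
      ... | inj₂ x∈S   = S⊆U x∈S
    ... | w , w∈U , y∪S→w
      with Star-dominated (λ x x∈S → y∪S→w x (x∈p∪q⁺ {p = ⁅ y ⁆} (inj₂ x∈S)))
         | y∪S→w y (x∈p∪q⁺ (inj₁ (x∈⁅x⁆ y)))
    ... | inj₂ (_ , S→w)      | y→w = inj₁ (w , w∈U , S→w , y→w)
    ... | inj₁ (w∈S , sinkS) | y→w = inj₂ (w , w∈S , sinkS , Star-strict {E = T} y→w λ { refl → y∉S w∈S })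

    -- A sink w of S is not a sink of U, so some y ∈ U beats w; a sink of
    -- S that y beats would be a second sink of S.
    sinkless⇒dominating : ¬ HasSink U → IsDominatingOn d U T
    sinkless⇒dominating noSink S S⊆U 1≤∣S∣ ∣S∣≤d
      with dom S S⊆U 1≤∣S∣ (m≤n⇒m≤1+n ∣S∣≤d)
    ... | w , w∈U , S→*w with Star-dominated S→*w
    ...   | inj₂ (_ , S→w) = w , w∈U , S→w
    ...   | inj₁ (w∈S , sinkS)
      with ¬Sink⇒out-neighbour (λ sinkU → noSink (w , w∈U , sinkU))
    ... | y , y∈U , w→y
      with extend S⊆U ∣S∣≤d y∈U (λ y∈S → asym w→y (sinkS y y∈S λ { refl → irrefl w→y }))
    ... | inj₁ (w′ , w′∈U , S→w′ , _) = w′ , w′∈U , S→w′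
    ... | inj₂ (s , s∈S , sinkS′ , y→s) =
      ⊥-elim (asym w→y (subst (T y) (sink-unique s∈S w∈S sinkS′ sinkS) y→s))

  -- If S dominates only v, every out-neighbour y of v lies outside S, and
  -- extending S by y either gives a dominated vertex other than v or a sink
  -- of S beaten by y.  Choosing y beaten by v and by a first such sink s,
  -- the second sink would be a different sink of S.
  vertex-deleted-dominating : ∀ {d} → 2 ≤ d → IsDominating d T → IsDominating (suc d) (Star T) →
                              ∀ v → IsDominatingOn d (∁ ⁅ v ⁆) T
  vertex-deleted-dominating 2≤d domT domT* v S _ 1≤∣S∣ ∣S∣≤d
    with domT S (λ _ → ∈⊤) 1≤∣S∣ ∣S∣≤d
  ... | w , _ , S→w with w ≟ v
  ...   | no w≢v   = w , x∉p⇒x∈∁p (w≢v ∘ x∈⁅y⁆⇒x≡y v) , S→w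
  ...   | yes refl = avoiding-w
    where
    Success : Set
    Success = ∃ λ u → u ∈ ∁ ⁅ w ⁆ × Dominates T S u

    escape : ∀ {y} → T w y → Success ⊎ (∃ λ s → s ∈ S × Sink S s × T y s)
    escape w→y with extend domT* (λ _ → ∈⊤) ∣S∣≤d ∈⊤ (λ y∈S → asym (S→w _ y∈S) w→y)
    ... | inj₁ (u , _ , S→u , y→u) =
      inj₁ (u , x∉p⇒x∈∁p (λ u∈⁅w⁆ → Star-asym (subst (Star T _) (x∈⁅y⁆⇒x≡y w u∈⁅w⁆) y→u) w→y) , S→u)
    ... | inj₂ sink = inj₂ sink

    avoiding-w : Success
    avoiding-w with escape (proj₂ (out-neighbour domT (≤-trans (n≤1+n 1) 2≤d) w))
    ... | inj₁ success = success
    ... | inj₂ (s , s∈S , sinkS , _) with common-out-neighbour domT 2≤d s w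
    ...   | u , s→u , w→u with escape w→u
    ...     | inj₁ success = success
    ...     | inj₂ (s′ , s′∈S , sinkS′ , u→s′) =
      ⊥-elim (asym s→u (subst (T u) (sink-unique s′∈S s∈S sinkS′ sinkS) u→s′))

  critical⇒¬Star-dominating : ∀ {d} → 2 ≤ d → IsCriticalDominating d T → Fin n →
                              ¬ IsDominating (suc d) (Star T)
  critical⇒¬Star-dominating 2≤d critical z domT*
    with out-neighbour (proj₁ critical) (≤-trans (n≤1+n 1) 2≤d) z
  ... | u , z→u =
    critical⇒¬dominatingOn critical
      (u , x∉p⇒x∈∁p (λ u∈⁅z⁆ → irrefl (subst (T z) (x∈⁅y⁆⇒x≡y z u∈⁅z⁆) z→u)))
      (z , λ z∈∁z → x∈∁p⇒x∉p z∈∁z (x∈⁅x⁆ z))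
      (vertex-deleted-dominating 2≤d (proj₁ critical) domT* z)

  critical⇒Star-dominating-part-has-sink : ∀ {d U} → 2 ≤ d → IsCriticalDominating d T →
    IsDominatingOn (suc d) U (Star T) → Nonempty U → HasSink U
  critical⇒Star-dominating-part-has-sink {U = U} 2≤d critical dom nonempty with hasSink? U
  ... | yes sink = sink
  ... | no noSink with all? (_∈? U)
  ...   | yes full = ⊥-elim (critical⇒¬Star-dominating 2≤d critical (proj₁ nonempty)
                               (IsDominatingOn-full full dom))
  ...   | no ¬full = ⊥-elim (critical⇒¬dominatingOn critical nonempty
                               (¬∀⟶∃¬ n _ (_∈? U) ¬full) (sinkless⇒dominating dom noSink))

  sinkSet : Subset n → Subset n
  sinkSet U with hasSink? U
  ... | yes (s , _) = ⁅ s ⁆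
  ... | no _        = ⊥

  ∣sinkSet∣≤1 : ∀ U → ∣ sinkSet U ∣ ≤ 1
  ∣sinkSet∣≤1 U with hasSink? U
  ... | yes (s , _) = ≤-reflexive (∣⁅x⁆∣≡1 s)
  ... | no _        = ≤-trans (≤-reflexive (∣⊥∣≡0 n)) z≤n

  sinkSet-sound : ∀ {U s} → s ∈ sinkSet U → s ∈ U × Sink U s
  sinkSet-sound {U} s∈ with hasSink? U
  ... | yes (s , s∈U , sink) rewrite x∈⁅y⁆⇒x≡y s s∈ = s∈U , sink
  ... | no _ = ⊥-elim (∉⊥ s∈)

  sinkSet-complete : ∀ {U} → HasSink U → ∃ λ s → s ∈ sinkSet U
  sinkSet-complete {U} sink with hasSink? U
  ... | yes (s , _) = s , x∈⁅x⁆ s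
  ... | no noSink   = ⊥-elim (noSink sink)

  covered-by-sinks⇒¬dominating : ∀ {d t} → t ≤ d → (V : Fin t → Subset n) →
    (∀ i → Nonempty (V i) → HasSink (V i)) → (∀ v → ∃ λ i → v ∈ V i) →
    Fin n → ¬ IsDominating d T
  covered-by-sinks⇒¬dominating {d} t≤d V sinks cover z domT =
    X-undominated (domT X (λ _ → ∈⊤) (x∈p⇒1≤∣p∣ (proj₁ (proj₂ (sink-in-X z)))) ∣X∣≤d)
    where
    X : Subset n
    X = ⋃ (tabulate (sinkSet ∘ V))

    ∣X∣≤d : ∣ X ∣ ≤ d
    ∣X∣≤d = ≤-trans (∣⋃∣≤length (All.tabulate⁺ (∣sinkSet∣≤1 ∘ V)))
                    (≤-trans (≤-reflexive (length-tabulate (sinkSet ∘ V))) t≤d)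

    sink-in-X : ∀ v → ∃ λ s → s ∈ X × ∃ λ i → v ∈ V i × Sink (V i) s
    sink-in-X v with cover v
    ... | i , v∈Vi with sinkSet-complete (sinks i (v , v∈Vi))
    ...   | s , s∈ = s , x∈⋃⁺ (Any.tabulate⁺ i s∈) , i , v∈Vi , proj₂ (sinkSet-sound s∈)

    X-undominated : ¬ (∃ λ w → w ∈ ⊤ × Dominates T X w)
    X-undominated (w , _ , X→w) with sink-in-X w
    ... | s , s∈X , i , w∈Vi , sink =
      asym (X→w s s∈X) (sink w w∈Vi λ { refl → irrefl (X→w s s∈X) })

lemma3p5 : (d n : ℕ) → 2 ≤ d → 1 ≤ n → (T : Digraph n) → IsTournament T →
    IsCriticalDominating d T →
    ¬ (Σ ℕ λ t → t ≤ d × Σ (Fin t → Subgraph (Star T)) λ H →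
         (∀ i → IsDominatingSub (suc d) (H i)) ×
         (∀ v → ∃ λ i → v ∈ verts (H i)))
lemma3p5 d (suc m) 2≤d _ T tournament critical (t , t≤d , H , dominating , cover) =
  covered-by-sinks⇒¬dominating t≤d (verts ∘ H)
    (λ i → critical⇒Star-dominating-part-has-sink 2≤d critical (Star-dominating i))
    cover zero (proj₁ critical)
  where
  open Tournament tournament
  Star-dominating : ∀ i → IsDominatingOn (suc d) (verts (H i)) (Star T)
  Star-dominating i =
    IsDominatingOn-mono (λ x y e → proj₂ (proj₂ (edges⊆ (H i) x y e))) (dominating i)
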